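{- If $M[x:=N]:\langle\Gamma\vdash U\rangle$, $x\in FV(M)$ and $x\notin FV(N)$, then there exist a type $V\in\mathbb U$ and type environments $\Gamma_1,\Gamma_2$ such that $M:\langle\Gamma_1,x:V\vdash U\rangle$, $N:\langle\Gamma_2\vdash V\rangle$, and $\Gamma\sqsubseteq\Gamma_1\sqcap\Gamma_2$.
   Context: Terms: $\mathcal V$ is a denumerably infinite set of variables; $\mathcal M$ is the set of untyped $\lambda$-terms $M::=x\mid \lambda x.M\mid MM$ taken modulo $\alpha$-conversion; $FV(M)$ is the set of free variables; $M[x:=N]$ is capture-avoiding substitution. Types: $\mathcal A$ is a denumerably infinite set of atomic types; $\mathbb T::=a\mid \mathbb U\to\mathbb T$ ($a\in\mathcal A$) and $\mathbb U::=\omega\mid \mathbb U\sqcap\mathbb U\mid \mathbb T$; types are quotiented by commutativity, associativity and idempotence of $\sqcap$ and by $\omega\sqcap U=U$. $T$ ranges over $\mathbb T$, $U,V$ over $\mathbb U$. Environments: a type environment is a finite set $(x_i:U_i)_n$ of declarations with pairwise distinct variables; $dom$ is its set of variables; $\Gamma,x:U$ requires $x\notin dom(\Gamma)$; $env^M_\omega$ assigns $\omega$ to each variable of $FV(M)$ and nothing else; if $\Gamma_1=(x_i:U_i)_n,(y_j:V_j)_m$ and $\Gamma_2=(x_i:U'_i)_n,(z_k:W_k)_l$ with the $y_j$, $z_k$ all distinct, then $\Gamma_1\sqcap\Gamma_2=(x_i:U_i\sqcap U'_i)_n,(y_j:V_j)_m,(z_k:W_k)_l$. Subtyping: $\sqsubseteq$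 (on types, on environments, and on typings $\langle\Gamma\vdash U\rangle$) is the least relation closed under: $\Phi\sqsubseteq\Phi$; transitivity; $U_1\sqcap U_2\sqsubseteq U_1$; if $U_1\sqsubseteq V_1$ and $U_2\sqsubseteq V_2$ then $U_1\sqcap U_2\sqsubseteq V_1\sqcap V_2$; if $U_2\sqsubseteq U_1$ and $T_1\sqsubseteq T_2$ then $U_1\to T_1\sqsubseteq U_2\to T_2$; if $U_1\sqsubseteq U_2$ and $x\notin dom(\Gamma)$ then $\Gamma,x:U_1\sqsubseteq\Gamma,x:U_2$; if $U_1\sqsubseteq U_2$ and $\Gamma_2\sqsubseteq\Gamma_1$ then $\langle\Gamma_1\vdash U_1\rangle\sqsubseteq\langle\Gamma_2\vdash U_2\rangle$. Typing rules for $M:\langle\Gamma\vdash U\rangle$: (ax) $x:\langle x:T\vdash T\rangle$ for $T\in\mathbb T$; ($\omega$) $M:\langle env^M_\omega\vdash\omega\rangle$; ($\to_i$) from $M:\langle\Gamma,x:U\vdash T\rangle$ infer $\lambda x.M:\langle\Gamma\vdash U\to T\rangle$; ($\to'_i$) from $M:\langle\Gamma\vdash T\rangle$ and $x\notin dom(\Gamma)$ infer $\lambda x.M:\langle\Gamma\vdash\omega\to T\rangle$; ($\to_e$) from $M_1:\langle\Gamma_1\vdash U\to T\rangle$ and $M_2:\langle\Gamma_2\vdash U\rangle$ infer $M_1M_2:\langle\Gamma_1\sqcap\Gamma_2\vdash T\rangle$; ($\sqcap_i$) from $M:\langle\Gamma\vdash U_1\rangle$ and $M:\langle\Gamma\vdash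 U_2\rangle$ infer $M:\langle\Gamma\vdash U_1\sqcap U_2\rangle$; ($\sqsubseteq$) from $M:\langle\Gamma\vdash U\rangle$ and $\langle\Gamma\vdash U\rangle\sqsubseteq\langle\Gamma'\vdash U'\rangle$ infer $M:\langle\Gamma'\vdash U'\rangle$. -}

module Defs where

open import Data.Nat using (ℕ; zero; suc; _≡ᵇ_)
open import Data.Fin using (Fin; zero; suc; punchIn; inject₁)
open import Data.Bool using (if_then_else_)
open import Data.List using (List; []; _∷_; _++_; map; mapMaybe)
open import Data.Maybe using (Maybe; just; nothing)
import Data.Maybe as Maybe
open import Data.Product using (_×_; _,_; proj₁)
open import Relation.Binary.PropositionalEquality using (_≡_)

-- Terms modulo α: well-scoped locally nameless syntax.
-- Free variables are names in 𝒱 = ℕ; bound variables are de Bruijn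
-- indices.  Tm 0 is exactly the set 𝓜 of λ-terms modulo α-conversion.

data Tm (n : ℕ) : Set where
  bv  : Fin n → Tm n
  fv  : ℕ → Tm n
  lam : Tm (suc n) → Tm n
  app : Tm n → Tm n → Tm n

closeAt : ∀ {n} → ℕ → Fin (suc n) → Tm n → Tm (suc n)
closeAt x k (bv i)    = bv (punchIn k i)
closeAt x k (fv y)    = if y ≡ᵇ x then bv k else fv y
closeAt x k (lam B)   = lam (closeAt x (suc k) B)
closeAt x k (app M N) = app (closeAt x k M) (closeAt x k N)

ƛ : ∀ {n} → ℕ → Tm n → Tm n
ƛ x M = lam (closeAt x zero M)

weaken : ∀ {n} → Tm n → Tm (suc n)
weaken (bv i)    = bv (inject₁ i)
weaken (fv y)    = fv y
weaken (lam B)   = lam (weaken B)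
weaken (app M N) = app (weaken M) (weaken N)

weakenTo : ∀ n → Tm 0 → Tm n
weakenTo zero    N = N
weakenTo (suc n) N = weaken (weakenTo n N)

substAt : ∀ {n} → Tm n → ℕ → Tm 0 → Tm n
substAt {n} (bv i) x N = bv i
substAt {n} (fv y) x N = if y ≡ᵇ x then weakenTo n N else fv y
substAt (lam B)   x N = lam (substAt B x N)
substAt (app M P) x N = app (substAt M x N) (substAt P x N)

_[_≔_] : Tm 0 → ℕ → Tm 0 → Tm 0
M [ x ≔ N ] = substAt M x N

-- free variables (as a list; membership = FV)
fvs : ∀ {n} → Tm n → List ℕ
fvs (bv i)    = []
fvs (fv y)    = y ∷ []
fvs (lam B)   = fvs B
fvs (app M N) = fvs M ++ fvs N

-- Types (atoms 𝒜 = ℕ), as raw syntax; the quotient by ACI of ⊓ and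
-- ω ⊓ U = U is handled by the equivalence _≈_ below.

mutual
  data 𝕋 : Set where
    atom : ℕ → 𝕋
    _⇒_  : 𝕌 → 𝕋 → 𝕋

  data 𝕌 : Set where
    ω   : 𝕌
    _⊓_ : 𝕌 → 𝕌 → 𝕌
    ⌜_⌝ : 𝕋 → 𝕌

infixr 7 _⇒_
infixl 8 _⊓_

data _≈_ : 𝕌 → 𝕌 → Set where
  ≈-refl  : ∀ {U} → U ≈ U
  ≈-sym   : ∀ {U V} → U ≈ V → V ≈ U
  ≈-trans : ∀ {U V W} → U ≈ V → V ≈ W → U ≈ W
  ≈-comm  : ∀ {U V} → (U ⊓ V) ≈ (V ⊓ U)
  ≈-assoc : ∀ {U V W} → ((U ⊓ V) ⊓ W) ≈ (U ⊓ (V ⊓ W))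
  ≈-idem  : ∀ {U} → (U ⊓ U) ≈ U
  ≈-unit  : ∀ {U} → (ω ⊓ U) ≈ U
  ≈-⊓     : ∀ {U U′ V V′} → U ≈ U′ → V ≈ V′ → (U ⊓ V) ≈ (U′ ⊓ V′)
  ≈-⇒     : ∀ {U U′ T T′} → U ≈ U′ → ⌜ T ⌝ ≈ ⌜ T′ ⌝ → ⌜ U ⇒ T ⌝ ≈ ⌜ U′ ⇒ T′ ⌝

-- subtyping on types (on equivalence classes: ≈ ⊆ ⊑ gives Φ ⊑ Φ)
data _⊑_ : 𝕌 → 𝕌 → Set where
  ⊑-≈     : ∀ {U V} → U ≈ V → U ⊑ V
  ⊑-trans : ∀ {U V W} → U ⊑ V → V ⊑ W → U ⊑ W
  ⊑-proj  : ∀ {U₁ U₂} → (U₁ ⊓ U₂) ⊑ U₁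
  ⊑-⊓     : ∀ {U₁ U₂ V₁ V₂} → U₁ ⊑ V₁ → U₂ ⊑ V₂ → (U₁ ⊓ U₂) ⊑ (V₁ ⊓ V₂)
  ⊑-⇒     : ∀ {U₁ U₂ T₁ T₂} → U₂ ⊑ U₁ → ⌜ T₁ ⌝ ⊑ ⌜ T₂ ⌝ → ⌜ U₁ ⇒ T₁ ⌝ ⊑ ⌜ U₂ ⇒ T₂ ⌝

-- Environments: finite partial maps 𝒱 ⇀ 𝕌, represented by association
-- lists read through `look` (first binding wins); two lists denote the
-- same environment iff their lookups agree.

Env : Set
Env = List (ℕ × 𝕌)

look : Env → ℕ → Maybe 𝕌
look []            y = nothing
look ((z , U) ∷ Γ) y = if y ≡ᵇ z then just U else look Γ y

_∉dom_ : ℕ → Env → Set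
x ∉dom Γ = look Γ x ≡ nothing

-- Γ , x : U   (only used with the side condition x ∉dom Γ)
_,_∶_ : Env → ℕ → 𝕌 → Env
Γ , x ∶ U = (x , U) ∷ Γ

infixl 5 _,_∶_

env-ω : Tm 0 → Env
env-ω M = map (λ y → (y , ω)) (fvs M)

meetM : Maybe 𝕌 → Maybe 𝕌 → Maybe 𝕌
meetM (just U) (just V) = just (U ⊓ V)
meetM (just U) nothing  = just U
meetM nothing  m        = m

_⊓ₑ_ : Env → Env → Env
Γ₁ ⊓ₑ Γ₂ = mapMaybe (λ y → Maybe.map (λ U → (y , U)) (meetM (look Γ₁ y) (look Γ₂ y)))
                    (map proj₁ Γ₁ ++ map proj₁ Γ₂)

data _⊑ₑ_ : Env → Env → Set where
  ⊑ₑ-refl  : ∀ {Γ Δ} → (∀ y → look Γ y ≡ look Δ y) → Γ ⊑ₑ Δ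
  ⊑ₑ-trans : ∀ {Γ Δ Θ} → Γ ⊑ₑ Δ → Δ ⊑ₑ Θ → Γ ⊑ₑ Θ
  ⊑ₑ-ext   : ∀ {Γ x U₁ U₂} → x ∉dom Γ → U₁ ⊑ U₂ → (Γ , x ∶ U₁) ⊑ₑ (Γ , x ∶ U₂)

data ⟨_⊢_⟩⊑⟨_⊢_⟩ : Env → 𝕌 → Env → 𝕌 → Set where
  ⊑ₜ-refl  : ∀ {Γ U} → ⟨ Γ ⊢ U ⟩⊑⟨ Γ ⊢ U ⟩
  ⊑ₜ-trans : ∀ {Γ U Γ′ U′ Γ″ U″} → ⟨ Γ ⊢ U ⟩⊑⟨ Γ′ ⊢ U′ ⟩ → ⟨ Γ′ ⊢ U′ ⟩⊑⟨ Γ″ ⊢ U″ ⟩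
           → ⟨ Γ ⊢ U ⟩⊑⟨ Γ″ ⊢ U″ ⟩
  ⊑ₜ-rule  : ∀ {Γ₁ U₁ Γ₂ U₂} → U₁ ⊑ U₂ → Γ₂ ⊑ₑ Γ₁ → ⟨ Γ₁ ⊢ U₁ ⟩⊑⟨ Γ₂ ⊢ U₂ ⟩

data _∶⟨_⊢_⟩ : Tm 0 → Env → 𝕌 → Set where
  ax   : ∀ {x T} → fv x ∶⟨ [] , x ∶ ⌜ T ⌝ ⊢ ⌜ T ⌝ ⟩
  ω-r  : ∀ {M} → M ∶⟨ env-ω M ⊢ ω ⟩
  →i   : ∀ {M Γ x U T} → x ∉dom Γ → M ∶⟨ Γ , x ∶ U ⊢ ⌜ T ⌝ ⟩
       → ƛ x M ∶⟨ Γ ⊢ ⌜ U ⇒ T ⌝ ⟩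
  →i′  : ∀ {M Γ x T} → M ∶⟨ Γ ⊢ ⌜ T ⌝ ⟩ → x ∉dom Γ
       → ƛ x M ∶⟨ Γ ⊢ ⌜ ω ⇒ T ⌝ ⟩
  →e   : ∀ {M₁ M₂ Γ₁ Γ₂ U T} → M₁ ∶⟨ Γ₁ ⊢ ⌜ U ⇒ T ⌝ ⟩ → M₂ ∶⟨ Γ₂ ⊢ U ⟩
       → app M₁ M₂ ∶⟨ Γ₁ ⊓ₑ Γ₂ ⊢ ⌜ T ⌝ ⟩
  ⊓i   : ∀ {M Γ U₁ U₂} → M ∶⟨ Γ ⊢ U₁ ⟩ → M ∶⟨ Γ ⊢ U₂ ⟩ → M ∶⟨ Γ ⊢ U₁ ⊓ U₂ ⟩
  ⊑r   : ∀ {M Γ U Γ′ U′} → M ∶⟨ Γ ⊢ U ⟩ → ⟨ Γ ⊢ U ⟩⊑⟨ Γ′ ⊢ U′ ⟩ → M ∶⟨ Γ′ ⊢ U′ ⟩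

module Submission where

-- The proof is by induction on the size of the typing derivation of
-- M[x:=N], with a case analysis on M.  The abstraction cases rename the bound variable to a fresh
--      one by a swap, which is why the induction is on derivation size.

open import Defs
open import Data.Nat using (ℕ; zero; suc; _≡ᵇ_; _+_; _≤_; z≤n; s≤s)
open import Data.Nat.Properties using (≡ᵇ⇒≡; _≟_; 1+n≰n; ≤-refl; ≤-trans; m≤m+n; m≤n+m; m+n≤o⇒m≤o; m+n≤o⇒n≤o; +-mono-≤)
open import Data.Nat.ListAction using (sum)
open import Data.Fin using (Fin; zero; suc; punchIn; punchOut; inject₁; fromℕ)
import Data.Fin as Fin
import Data.Fin.Properties as Finₚ
open import Data.Bool using (true; false; if_then_else_; T)
open import Data.Unit using (⊤; tt)
open import Data.Empty using (⊥; ⊥-elim)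
open import Data.List using (List; []; _∷_; _++_; map; mapMaybe)
open import Data.List.Properties using (map-++)
open import Data.List.Membership.Propositional using (_∈_; _∉_)
open import Data.List.Membership.Propositional.Properties using (∈-++⁺ˡ; ∈-++⁺ʳ; ∈-++⁻; ∈-map⁺; ∈-map⁻)
open import Data.List.Membership.DecPropositional _≟_ using (_∈?_)
open import Data.List.Relation.Unary.Any using (here; there)
open import Data.Maybe using (Maybe; just; nothing)
import Data.Maybe as Maybe
open import Data.Product using (Σ; _×_; _,_; proj₁; proj₂)
open import Data.Sum using (_⊎_; inj₁; inj₂)
open import Relation.Nullary using (yes; no)
open import Relation.Binary.PropositionalEquality

-- 1. Environments as partial maps

≡ᵇ-refl : ∀ n → (n ≡ᵇ n) ≡ true
≡ᵇ-refl zero    = refl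
≡ᵇ-refl (suc n) = ≡ᵇ-refl n

≡ᵇ-≢ : ∀ {m n} → m ≢ n → (m ≡ᵇ n) ≡ false
≡ᵇ-≢ {m} {n} m≢n with m ≡ᵇ n in eq
... | false = refl
... | true  = ⊥-elim (m≢n (≡ᵇ⇒≡ m n (subst T (sym eq) tt)))

if-≡ : ∀ {A : Set} {y z : ℕ} {a b : A} → y ≡ z → (if y ≡ᵇ z then a else b) ≡ a
if-≡ {y = y} refl rewrite ≡ᵇ-refl y = refl

if-≢ : ∀ {A : Set} {y z : ℕ} {a b : A} → y ≢ z → (if y ≡ᵇ z then a else b) ≡ b
if-≢ y≢z rewrite ≡ᵇ-≢ y≢z = refl

look-here : ∀ {Γ y U} → look ((y , U) ∷ Γ) y ≡ just U
look-here {Γ} {y} {U} = if-≡ {y = y} {z = y} {b = look Γ y} refl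

look-there : ∀ {Γ y z U} → y ≢ z → look ((z , U) ∷ Γ) y ≡ look Γ y
look-there {Γ} {y} {z} {U} = if-≢ {y = y} {z = z} {a = just U} {b = look Γ y}

⊑-refl : ∀ {U} → U ⊑ U
⊑-refl = ⊑-≈ ≈-refl

-- Subtyping lifted to optional types: the value of a lookup.  An absent
-- declaration is only related to an absent one, since ⊑ₑ never changes
-- the domain of an environment.
data _⊑ᵐ_ : Maybe 𝕌 → Maybe 𝕌 → Set where
  nothing⊑ : nothing ⊑ᵐ nothing
  just⊑    : ∀ {U V} → U ⊑ V → just U ⊑ᵐ just V

⊑ᵐ-refl : ∀ {a} → a ⊑ᵐ a
⊑ᵐ-refl {nothing} = nothing⊑
⊑ᵐ-refl {just _}  = just⊑ ⊑-refl

⊑ᵐ-reflexive : ∀ {a b} → a ≡ b → a ⊑ᵐ b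
⊑ᵐ-reflexive refl = ⊑ᵐ-refl

⊑ᵐ-trans : ∀ {a b c} → a ⊑ᵐ b → b ⊑ᵐ c → a ⊑ᵐ c
⊑ᵐ-trans nothing⊑  nothing⊑  = nothing⊑
⊑ᵐ-trans (just⊑ p) (just⊑ q) = just⊑ (⊑-trans p q)

⊑ᵐ-nothingˡ : ∀ {a b} → a ⊑ᵐ b → b ≡ nothing → a ≡ nothing
⊑ᵐ-nothingˡ nothing⊑ _ = refl

⊑ᵐ-nothingʳ : ∀ {a b} → a ⊑ᵐ b → a ≡ nothing → b ≡ nothing
⊑ᵐ-nothingʳ nothing⊑ _ = refl

⊑ᵐ-justˡ : ∀ {U b} → just U ⊑ᵐ b → Σ 𝕌 (λ U′ → b ≡ just U′ × U ⊑ U′)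
⊑ᵐ-justˡ (just⊑ U⊑U′) = _ , refl , U⊑U′

meet-mono : ∀ {a a′ b b′} → a ⊑ᵐ a′ → b ⊑ᵐ b′ → meetM a b ⊑ᵐ meetM a′ b′
meet-mono nothing⊑  nothing⊑  = nothing⊑
meet-mono nothing⊑  (just⊑ q) = just⊑ q
meet-mono (just⊑ p) nothing⊑  = just⊑ p
meet-mono (just⊑ p) (just⊑ q) = just⊑ (⊑-⊓ p q)

meet-comm : ∀ a b → meetM a b ⊑ᵐ meetM b a
meet-comm nothing  nothing  = nothing⊑
meet-comm nothing  (just _) = ⊑ᵐ-refl
meet-comm (just _) nothing  = ⊑ᵐ-refl
meet-comm (just _) (just _) = just⊑ (⊑-≈ ≈-comm)

meet-assoc : ∀ a b c → meetM (meetM a b) c ⊑ᵐ meetM a (meetM b c)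
meet-assoc nothing  nothing  _        = ⊑ᵐ-refl
meet-assoc nothing  (just _) _        = ⊑ᵐ-refl
meet-assoc (just _) nothing  _        = ⊑ᵐ-refl
meet-assoc (just _) (just _) nothing  = ⊑ᵐ-refl
meet-assoc (just _) (just _) (just _) = just⊑ (⊑-≈ ≈-assoc)

meet-assoc˘ : ∀ a b c → meetM a (meetM b c) ⊑ᵐ meetM (meetM a b) c
meet-assoc˘ nothing  nothing  _        = ⊑ᵐ-refl
meet-assoc˘ nothing  (just _) _        = ⊑ᵐ-refl
meet-assoc˘ (just _) nothing  _        = ⊑ᵐ-refl
meet-assoc˘ (just _) (just _) nothing  = ⊑ᵐ-refl
meet-assoc˘ (just _) (just _) (just _) = just⊑ (⊑-≈ (≈-sym ≈-assoc))

meet-idem : ∀ a → a ⊑ᵐ meetM a a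
meet-idem nothing  = nothing⊑
meet-idem (just _) = just⊑ (⊑-≈ (≈-sym ≈-idem))

meet-nothing : ∀ a b → meetM a b ≡ nothing → a ≡ nothing × b ≡ nothing
meet-nothing nothing  nothing  _ = refl , refl
meet-nothing nothing  (just _) ()
meet-nothing (just _) nothing  ()
meet-nothing (just _) (just _) ()

meet-nothingʳ : ∀ a → meetM a nothing ≡ a
meet-nothingʳ nothing  = refl
meet-nothingʳ (just _) = refl

meet-interchange : ∀ a b c e → meetM (meetM a c) (meetM b e) ⊑ᵐ meetM (meetM a b) (meetM c e)
meet-interchange a b c e =
  ⊑ᵐ-trans (meet-assoc a c (meetM b e))
  (⊑ᵐ-trans (meet-mono (⊑ᵐ-refl {a}) (meet-assoc˘ c b e))
  (⊑ᵐ-trans (meet-mono (⊑ᵐ-refl {a}) (meet-mono (meet-comm c b) (⊑ᵐ-refl {e})))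
  (⊑ᵐ-trans (meet-mono (⊑ᵐ-refl {a}) (meet-assoc b c e))
  (meet-assoc˘ a b (meetM c e)))))

SameDom : Maybe 𝕌 → Maybe 𝕌 → Set
SameDom nothing  nothing  = ⊤
SameDom (just _) (just _) = ⊤
SameDom _        _        = ⊥

meet-projˡ : ∀ a b → SameDom a b → meetM a b ⊑ᵐ a
meet-projˡ nothing  nothing  _ = nothing⊑
meet-projˡ (just _) (just _) _ = just⊑ ⊑-proj

meet-projʳ : ∀ a b → SameDom a b → meetM a b ⊑ᵐ b
meet-projʳ nothing  nothing  _ = nothing⊑
meet-projʳ (just _) (just _) _ = just⊑ (⊑-trans (⊑-≈ ≈-comm) ⊑-proj)

_⊑ᵖ_ : Env → Env → Set
Γ ⊑ᵖ Δ = ∀ y → look Γ y ⊑ᵐ look Δ y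

⊑ₑ⇒⊑ᵖ : ∀ {Γ Δ} → Γ ⊑ₑ Δ → Γ ⊑ᵖ Δ
⊑ₑ⇒⊑ᵖ (⊑ₑ-refl eq)   y = ⊑ᵐ-reflexive (eq y)
⊑ₑ⇒⊑ᵖ (⊑ₑ-trans p q) y = ⊑ᵐ-trans (⊑ₑ⇒⊑ᵖ p y) (⊑ₑ⇒⊑ᵖ q y)
⊑ₑ⇒⊑ᵖ (⊑ₑ-ext {Γ} {x} {U₁} {U₂} _ s) y with y ≟ x
... | yes refl rewrite look-here {Γ} {y} {U₁} | look-here {Γ} {y} {U₂} = just⊑ s
... | no y≢x   rewrite look-there {Γ} {y} {x} {U₁} y≢x | look-there {Γ} {y} {x} {U₂} y≢x = ⊑ᵐ-refl

remove : ℕ → Env → Env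
remove k []            = []
remove k ((z , U) ∷ Γ) = if z ≡ᵇ k then remove k Γ else (z , U) ∷ remove k Γ

remove-here : ∀ k Γ → look (remove k Γ) k ≡ nothing
remove-here k [] = refl
remove-here k ((z , U) ∷ Γ) with z ≟ k
... | yes refl rewrite ≡ᵇ-refl z = remove-here z Γ
... | no z≢k rewrite ≡ᵇ-≢ z≢k | look-there {remove k Γ} {k} {z} {U} (λ e → z≢k (sym e)) = remove-here k Γ

remove-there : ∀ k Γ y → y ≢ k → look (remove k Γ) y ≡ look Γ y
remove-there k [] y _ = refl
remove-there k ((z , U) ∷ Γ) y y≢k with z ≟ k
... | yes refl rewrite ≡ᵇ-refl z | look-there {Γ} {y} {z} {U} y≢k = remove-there z Γ y y≢k
... | no z≢k rewrite ≡ᵇ-≢ z≢k with y ≟ z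
...   | yes refl rewrite look-here {remove k Γ} {y} {U} | look-here {Γ} {y} {U} = refl
...   | no y≢z rewrite look-there {remove k Γ} {y} {z} {U} y≢z | look-there {Γ} {y} {z} {U} y≢z =
  remove-there k Γ y y≢k

remove-∷ : ∀ {k z U} Γ → z ≢ k → remove k ((z , U) ∷ Γ) ≡ (z , U) ∷ remove k Γ
remove-∷ Γ z≢k rewrite ≡ᵇ-≢ z≢k = refl

remove-front : ∀ k Γ {U} → look Γ k ≡ just U → ∀ y → look Γ y ≡ look ((k , U) ∷ remove k Γ) y
remove-front k Γ {U} Γk y with y ≟ k
... | yes refl = trans Γk (sym (look-here {remove k Γ} {k} {U}))
... | no y≢k   = sym (trans (look-there {remove k Γ} {y} {k} {U} y≢k) (remove-there k Γ y y≢k))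

keys : Env → List ℕ
keys Γ = map proj₁ Γ

∉keys : ∀ Γ y → y ∉ keys Γ → look Γ y ≡ nothing
∉keys [] y _ = refl
∉keys ((z , U) ∷ Γ) y y∉ with y ≟ z
... | yes refl = ⊥-elim (y∉ (here refl))
... | no y≢z   = trans (look-there {Γ} {y} {z} {U} y≢z) (∉keys Γ y (λ m → y∉ (there m)))

-- Pointwise subtyping implies ⊑ₑ: the names in ks on which Γ and Δ may
-- differ are fixed one at a time, each by one ⊑ₑ-ext step.
⊑ᵖ⇒⊑ₑ-on : ∀ ks Γ Δ → (∀ y → y ∉ ks → look Γ y ≡ look Δ y) → Γ ⊑ᵖ Δ → Γ ⊑ₑ Δ
⊑ᵖ⇒⊑ₑ-on [] Γ Δ agree _ = ⊑ₑ-refl (λ y → agree y (λ ()))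
⊑ᵖ⇒⊑ₑ-on (k ∷ ks) Γ Δ agree Γ⊑Δ with look Γ k in Γk | look Δ k in Δk | Γ⊑Δ k
... | nothing | nothing | _ = ⊑ᵖ⇒⊑ₑ-on ks Γ Δ agree′ Γ⊑Δ
  where
  agree′ : ∀ y → y ∉ ks → look Γ y ≡ look Δ y
  agree′ y y∉ with y ≟ k
  ... | yes refl = trans Γk (sym Δk)
  ... | no y≢k   = agree y (λ { (here e) → y≢k e ; (there m) → y∉ m })
... | just U | just V | just⊑ U⊑V =
  ⊑ₑ-trans (⊑ₑ-refl (remove-front k Γ Γk))
    (⊑ₑ-trans (⊑ₑ-ext (remove-here k Γ) U⊑V) (⊑ᵖ⇒⊑ₑ-on ks Γ′ Δ agree′ Γ′⊑Δ))
  where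
  Γ′ : Env
  Γ′ = (k , V) ∷ remove k Γ
  Γ′-away : ∀ y → y ≢ k → look Γ′ y ≡ look Γ y
  Γ′-away y y≢k = trans (look-there {remove k Γ} {y} {k} {V} y≢k) (remove-there k Γ y y≢k)
  agree′ : ∀ y → y ∉ ks → look Γ′ y ≡ look Δ y
  agree′ y y∉ with y ≟ k
  ... | yes refl = trans (look-here {remove k Γ} {k} {V}) (sym Δk)
  ... | no y≢k   = trans (Γ′-away y y≢k) (agree y (λ { (here e) → y≢k e ; (there m) → y∉ m }))
  Γ′⊑Δ : Γ′ ⊑ᵖ Δ
  Γ′⊑Δ y with y ≟ k
  ... | yes refl rewrite look-here {remove y Γ} {y} {V} | Δk = ⊑ᵐ-refl
  ... | no y≢k   rewrite Γ′-away y y≢k = Γ⊑Δ y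

⊑ᵖ⇒⊑ₑ : ∀ {Γ Δ} → Γ ⊑ᵖ Δ → Γ ⊑ₑ Δ
⊑ᵖ⇒⊑ₑ {Γ} {Δ} = ⊑ᵖ⇒⊑ₑ-on (keys Γ ++ keys Δ) Γ Δ agree
  where
  agree : ∀ y → y ∉ keys Γ ++ keys Δ → look Γ y ≡ look Δ y
  agree y y∉ = trans (∉keys Γ y (λ m → y∉ (∈-++⁺ˡ m))) (sym (∉keys Δ y (λ m → y∉ (∈-++⁺ʳ (keys Γ) m))))

tabulate : (ℕ → Maybe 𝕌) → List ℕ → Env
tabulate h ks = mapMaybe (λ z → Maybe.map (λ U → (z , U)) (h z)) ks

tabulate-∉ : ∀ h ks y → y ∉ ks → look (tabulate h ks) y ≡ nothing
tabulate-∉ h [] y _ = refl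
tabulate-∉ h (z ∷ ks) y y∉ with h z
... | nothing = tabulate-∉ h ks y (λ m → y∉ (there m))
... | just W  = trans (look-there {tabulate h ks} {y} {z} {W} (λ e → y∉ (here e)))
                      (tabulate-∉ h ks y (λ m → y∉ (there m)))

tabulate-∈ : ∀ h ks y → y ∈ ks → look (tabulate h ks) y ≡ h y
tabulate-∈ h (z ∷ ks) y y∈ with y ≟ z
tabulate-∈ h (z ∷ ks) y y∈ | yes refl with h y in hy
... | just W = look-here {tabulate h ks} {y} {W}
... | nothing with y ∈? ks
...   | yes y∈ks = trans (tabulate-∈ h ks y y∈ks) hy
...   | no y∉ks  = tabulate-∉ h ks y y∉ks
tabulate-∈ h (z ∷ ks) y (here e)  | no y≢z = ⊥-elim (y≢z e)
tabulate-∈ h (z ∷ ks) y (there m) | no y≢z with h z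
... | nothing = tabulate-∈ h ks y m
... | just W  = trans (look-there {tabulate h ks} {y} {z} {W} y≢z) (tabulate-∈ h ks y m)

look-⊓ₑ : ∀ Γ₁ Γ₂ y → look (Γ₁ ⊓ₑ Γ₂) y ≡ meetM (look Γ₁ y) (look Γ₂ y)
look-⊓ₑ Γ₁ Γ₂ y with y ∈? (keys Γ₁ ++ keys Γ₂)
... | yes y∈ = tabulate-∈ (λ z → meetM (look Γ₁ z) (look Γ₂ z)) _ y y∈
... | no y∉ rewrite ∉keys Γ₁ y (λ m → y∉ (∈-++⁺ˡ m)) | ∉keys Γ₂ y (λ m → y∉ (∈-++⁺ʳ (keys Γ₁) m)) =
  tabulate-∉ (λ z → meetM (look Γ₁ z) (look Γ₂ z)) _ y y∉

⊑ₑ-⊓⇒meet : ∀ {Γ} Γ₁ Γ₂ → Γ ⊑ₑ (Γ₁ ⊓ₑ Γ₂) → ∀ y → look Γ y ⊑ᵐ meetM (look Γ₁ y) (look Γ₂ y)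
⊑ₑ-⊓⇒meet {Γ} Γ₁ Γ₂ Γ⊑ y = subst (look Γ y ⊑ᵐ_) (look-⊓ₑ Γ₁ Γ₂ y) (⊑ₑ⇒⊑ᵖ Γ⊑ y)

look-∷-cong : ∀ {Γ Δ} k U → (∀ y → look Γ y ≡ look Δ y) → ∀ y → look ((k , U) ∷ Γ) y ≡ look ((k , U) ∷ Δ) y
look-∷-cong k U Γ≡Δ y = cong (if y ≡ᵇ k then just U else_) (Γ≡Δ y)

look-∷-⊓ₑ : ∀ Γ Δ x U V y → look (((x , U) ∷ Γ) ⊓ₑ ((x , V) ∷ Δ)) y ≡ look ((x , U ⊓ V) ∷ (Γ ⊓ₑ Δ)) y
look-∷-⊓ₑ Γ Δ x U V y rewrite look-⊓ₑ ((x , U) ∷ Γ) ((x , V) ∷ Δ) y with y ≟ x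
... | yes refl rewrite look-here {Γ} {y} {U} | look-here {Δ} {y} {V} | look-here {Γ ⊓ₑ Δ} {y} {U ⊓ V} = refl
... | no y≢x   rewrite look-there {Γ} {y} {x} {U} y≢x | look-there {Δ} {y} {x} {V} y≢x
                     | look-there {Γ ⊓ₑ Δ} {y} {x} {U ⊓ V} y≢x = sym (look-⊓ₑ Γ Δ y)

look-∷-⊓ₑˡ : ∀ Γ Δ x U → x ∉dom Δ → ∀ y → look (((x , U) ∷ Γ) ⊓ₑ Δ) y ≡ look ((x , U) ∷ (Γ ⊓ₑ Δ)) y
look-∷-⊓ₑˡ Γ Δ x U x∉Δ y rewrite look-⊓ₑ ((x , U) ∷ Γ) Δ y with y ≟ x
... | yes refl rewrite look-here {Γ} {y} {U} | x∉Δ | look-here {Γ ⊓ₑ Δ} {y} {U} = refl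
... | no y≢x   rewrite look-there {Γ} {y} {x} {U} y≢x | look-there {Γ ⊓ₑ Δ} {y} {x} {U} y≢x = sym (look-⊓ₑ Γ Δ y)

look-∷-⊓ₑʳ : ∀ Γ Δ x V → x ∉dom Γ → ∀ y → look (Γ ⊓ₑ ((x , V) ∷ Δ)) y ≡ look ((x , V) ∷ (Γ ⊓ₑ Δ)) y
look-∷-⊓ₑʳ Γ Δ x V x∉Γ y rewrite look-⊓ₑ Γ ((x , V) ∷ Δ) y with y ≟ x
... | yes refl rewrite look-here {Δ} {y} {V} | x∉Γ | look-here {Γ ⊓ₑ Δ} {y} {V} = refl
... | no y≢x   rewrite look-there {Δ} {y} {x} {V} y≢x | look-there {Γ ⊓ₑ Δ} {y} {x} {V} y≢x = sym (look-⊓ₑ Γ Δ y)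

⊓ₑ-∉dom : ∀ {x} Γ Δ → x ∉dom Γ → x ∉dom Δ → x ∉dom (Γ ⊓ₑ Δ)
⊓ₑ-∉dom {x} Γ Δ x∉Γ x∉Δ rewrite look-⊓ₑ Γ Δ x | x∉Γ | x∉Δ = refl

⊓ₑ-identityʳ : ∀ Γ y → look (Γ ⊓ₑ []) y ≡ look Γ y
⊓ₑ-identityʳ Γ y = trans (look-⊓ₑ Γ [] y) (meet-nothingʳ (look Γ y))

⊓ₑ-identityˡ : ∀ Γ y → look ([] ⊓ₑ Γ) y ≡ look Γ y
⊓ₑ-identityˡ Γ y = look-⊓ₑ [] Γ y

⊑ₑ-⊓-identityʳ : ∀ Γ → Γ ⊑ₑ (Γ ⊓ₑ [])
⊑ₑ-⊓-identityʳ Γ = ⊑ₑ-refl (λ y → sym (⊓ₑ-identityʳ Γ y))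

⊑ₑ-⊓-idem : ∀ Γ → Γ ⊑ₑ (Γ ⊓ₑ Γ)
⊑ₑ-⊓-idem Γ = ⊑ᵖ⇒⊑ₑ λ y → subst (look Γ y ⊑ᵐ_) (sym (look-⊓ₑ Γ Γ y)) (meet-idem (look Γ y))

⊑ₑ-interchange : ∀ {Γ Δ} A B C E → Γ ⊑ₑ (A ⊓ₑ C) → Δ ⊑ₑ (B ⊓ₑ E) → (Γ ⊓ₑ Δ) ⊑ₑ ((A ⊓ₑ B) ⊓ₑ (C ⊓ₑ E))
⊑ₑ-interchange {Γ} {Δ} A B C E Γ⊑ Δ⊑ = ⊑ᵖ⇒⊑ₑ λ y →
  subst₂ _⊑ᵐ_ (sym (look-⊓ₑ Γ Δ y)) (sym (bound y))
    (⊑ᵐ-trans (meet-mono (⊑ₑ-⊓⇒meet A C Γ⊑ y) (⊑ₑ-⊓⇒meet B E Δ⊑ y))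
              (meet-interchange (look A y) (look B y) (look C y) (look E y)))
  where
  bound : ∀ y → look ((A ⊓ₑ B) ⊓ₑ (C ⊓ₑ E)) y ≡ meetM (meetM (look A y) (look B y)) (meetM (look C y) (look E y))
  bound y rewrite look-⊓ₑ (A ⊓ₑ B) (C ⊓ₑ E) y | look-⊓ₑ A B y | look-⊓ₑ C E y = refl

-- 2. Syntax: binders, swapping and substitution

∉-++ˡ : ∀ {y : ℕ} {xs ys} → y ∉ xs ++ ys → y ∉ xs
∉-++ˡ y∉ m = y∉ (∈-++⁺ˡ m)

∉-++ʳ : ∀ {y : ℕ} xs {ys} → y ∉ xs ++ ys → y ∉ ys
∉-++ʳ xs y∉ m = y∉ (∈-++⁺ʳ xs m)

close-fv⁻ : ∀ {n} z (k : Fin (suc n)) (P : Tm n) y → y ∈ fvs (closeAt z k P) → y ∈ fvs P × y ≢ z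
close-fv⁻ z k (bv i) y ()
close-fv⁻ z k (fv y′) y m with y′ ≟ z
... | yes refl rewrite ≡ᵇ-refl y′ with m
...   | ()
close-fv⁻ z k (fv y′) y m | no y′≢z rewrite ≡ᵇ-≢ y′≢z with m
...   | here refl = here refl , y′≢z
close-fv⁻ z k (lam P) y m = close-fv⁻ z (suc k) P y m
close-fv⁻ z k (app P Q) y m with ∈-++⁻ (fvs (closeAt z k P)) m
... | inj₁ m′ = let (y∈ , y≢z) = close-fv⁻ z k P y m′ in ∈-++⁺ˡ y∈ , y≢z
... | inj₂ m′ = let (y∈ , y≢z) = close-fv⁻ z k Q y m′ in ∈-++⁺ʳ (fvs P) y∈ , y≢z

close-fv⁺ : ∀ {n} z (k : Fin (suc n)) (P : Tm n) y → y ∈ fvs P → y ≢ z → y ∈ fvs (closeAt z k P)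
close-fv⁺ z k (bv i) y () _
close-fv⁺ z k (fv y′) y (here refl) y≢z rewrite ≡ᵇ-≢ y≢z = here refl
close-fv⁺ z k (lam P) y m y≢z = close-fv⁺ z (suc k) P y m y≢z
close-fv⁺ z k (app P Q) y m y≢z with ∈-++⁻ (fvs P) m
... | inj₁ m′ = ∈-++⁺ˡ (close-fv⁺ z k P y m′ y≢z)
... | inj₂ m′ = ∈-++⁺ʳ (fvs (closeAt z k P)) (close-fv⁺ z k Q y m′ y≢z)

openAt : ∀ {n} → ℕ → Fin (suc n) → Tm (suc n) → Tm n
openAt w k (bv i) with k Fin.≟ i
... | yes _  = fv w
... | no k≢i = bv (punchOut k≢i)
openAt w k (fv y)    = fv y
openAt w k (lam B)   = lam (openAt w (suc k) B)
openAt w k (app P Q) = app (openAt w k P) (openAt w k Q)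

open-close : ∀ {n} w (k : Fin (suc n)) (P : Tm n) → openAt w k (closeAt w k P) ≡ P
open-close w k (bv i) with k Fin.≟ punchIn k i
... | yes e  = ⊥-elim (Finₚ.punchInᵢ≢i k i (sym e))
... | no k≢i = cong bv (Finₚ.punchIn-injective k _ i (Finₚ.punchIn-punchOut k≢i))
open-close w k (fv y) with y ≟ w
... | yes refl rewrite ≡ᵇ-refl y with k Fin.≟ k
...   | yes _   = refl
...   | no k≢k  = ⊥-elim (k≢k refl)
open-close w k (fv y) | no y≢w rewrite ≡ᵇ-≢ y≢w = refl
open-close w k (lam P)   = cong lam (open-close w (suc k) P)
open-close w k (app P Q) = cong₂ app (open-close w k P) (open-close w k Q)

close-open : ∀ {n} w (k : Fin (suc n)) (B : Tm (suc n)) → w ∉ fvs B → closeAt w k (openAt w k B) ≡ B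
close-open w k (bv i) _ with k Fin.≟ i
... | yes refl rewrite ≡ᵇ-refl w = refl
... | no k≢i   = cong bv (Finₚ.punchIn-punchOut k≢i)
close-open w k (fv y) w∉ rewrite ≡ᵇ-≢ {y} {w} (λ e → w∉ (here (sym e))) = refl
close-open w k (lam B) w∉   = cong lam (close-open w (suc k) B w∉)
close-open w k (app P Q) w∉ = cong₂ app (close-open w k P (∉-++ˡ w∉)) (close-open w k Q (∉-++ʳ (fvs P) w∉))

close-injective : ∀ {n} w (k : Fin (suc n)) (P Q : Tm n) → closeAt w k P ≡ closeAt w k Q → P ≡ Q
close-injective w k P Q e = begin
  P                          ≡⟨ open-close w k P ⟨
  openAt w k (closeAt w k P) ≡⟨ cong (openAt w k) e ⟩
  openAt w k (closeAt w k Q) ≡⟨ open-close w k Q ⟩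
  Q                          ∎
  where open ≡-Reasoning

open-fv : ∀ {n} w (k : Fin (suc n)) (B : Tm (suc n)) y → y ∈ fvs B → y ∈ fvs (openAt w k B)
open-fv w k (bv i) y ()
open-fv w k (fv y′) y m = m
open-fv w k (lam B) y m = open-fv w (suc k) B y m
open-fv w k (app P Q) y m with ∈-++⁻ (fvs P) m
... | inj₁ m′ = ∈-++⁺ˡ (open-fv w k P y m′)
... | inj₂ m′ = ∈-++⁺ʳ (fvs (openAt w k P)) (open-fv w k Q y m′)

swap : ℕ → ℕ → ℕ → ℕ
swap a b y = if y ≡ᵇ a then b else (if y ≡ᵇ b then a else y)

swap-a : ∀ a b → swap a b a ≡ b
swap-a a b rewrite ≡ᵇ-refl a = refl

swap-b : ∀ a b → swap a b b ≡ a
swap-b a b with b ≟ a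
... | yes refl rewrite ≡ᵇ-refl b = refl
... | no b≢a   rewrite ≡ᵇ-≢ b≢a | ≡ᵇ-refl b = refl

swap-other : ∀ a b y → y ≢ a → y ≢ b → swap a b y ≡ y
swap-other a b y y≢a y≢b rewrite ≡ᵇ-≢ y≢a | ≡ᵇ-≢ y≢b = refl

swap-involutive : ∀ a b y → swap a b (swap a b y) ≡ y
swap-involutive a b y with y ≟ a
... | yes refl rewrite swap-a y b = swap-b y b
... | no y≢a with y ≟ b
...   | yes refl rewrite swap-b a y = swap-a a y
...   | no y≢b   rewrite swap-other a b y y≢a y≢b = swap-other a b y y≢a y≢b

swap-injective : ∀ a b {y z} → swap a b y ≡ swap a b z → y ≡ z
swap-injective a b {y} {z} e = begin
  y                       ≡⟨ swap-involutive a b y ⟨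
  swap a b (swap a b y)   ≡⟨ cong (swap a b) e ⟩
  swap a b (swap a b z)   ≡⟨ swap-involutive a b z ⟩
  z                       ∎
  where open ≡-Reasoning

swapTm : ∀ {n} → ℕ → ℕ → Tm n → Tm n
swapTm a b (bv i)    = bv i
swapTm a b (fv y)    = fv (swap a b y)
swapTm a b (lam P)   = lam (swapTm a b P)
swapTm a b (app P Q) = app (swapTm a b P) (swapTm a b Q)

swapTm-close : ∀ {n} a b z (k : Fin (suc n)) (P : Tm n) →
  swapTm a b (closeAt z k P) ≡ closeAt (swap a b z) k (swapTm a b P)
swapTm-close a b z k (bv i) = refl
swapTm-close a b z k (fv y) with y ≟ z
... | yes refl rewrite ≡ᵇ-refl y | ≡ᵇ-refl (swap a b y) = refl
... | no y≢z   rewrite ≡ᵇ-≢ y≢z | ≡ᵇ-≢ {swap a b y} {swap a b z} (λ e → y≢z (swap-injective a b e)) = refl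
swapTm-close a b z k (lam P)   = cong lam (swapTm-close a b z (suc k) P)
swapTm-close a b z k (app P Q) = cong₂ app (swapTm-close a b z k P) (swapTm-close a b z k Q)

swapTm-fresh : ∀ {n} a b (P : Tm n) → a ∉ fvs P → b ∉ fvs P → swapTm a b P ≡ P
swapTm-fresh a b (bv i) _ _ = refl
swapTm-fresh a b (fv y) a∉ b∉ = cong fv (swap-other a b y (λ e → a∉ (here (sym e))) (λ e → b∉ (here (sym e))))
swapTm-fresh a b (lam P) a∉ b∉ = cong lam (swapTm-fresh a b P a∉ b∉)
swapTm-fresh a b (app P Q) a∉ b∉ =
  cong₂ app (swapTm-fresh a b P (∉-++ˡ a∉) (∉-++ˡ b∉)) (swapTm-fresh a b Q (∉-++ʳ (fvs P) a∉) (∉-++ʳ (fvs P) b∉))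

fvs-swapTm : ∀ {n} a b (P : Tm n) → fvs (swapTm a b P) ≡ map (swap a b) (fvs P)
fvs-swapTm a b (bv i)    = refl
fvs-swapTm a b (fv y)    = refl
fvs-swapTm a b (lam P)   = fvs-swapTm a b P
fvs-swapTm a b (app P Q) rewrite fvs-swapTm a b P | fvs-swapTm a b Q = sym (map-++ (swap a b) (fvs P) (fvs Q))

swapTm-fv⁺ : ∀ {n} a b (P : Tm n) y → y ∈ fvs P → swap a b y ∈ fvs (swapTm a b P)
swapTm-fv⁺ a b P y m rewrite fvs-swapTm a b P = ∈-map⁺ (swap a b) m

swapTm-fv⁻ : ∀ {n} a b (P : Tm n) y → y ∈ fvs (swapTm a b P) → swap a b y ∈ fvs P
swapTm-fv⁻ a b P y m rewrite fvs-swapTm a b P with ∈-map⁻ (swap a b) m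
... | z , z∈ , refl rewrite swap-involutive a b z = z∈

fvs-weaken : ∀ {n} (P : Tm n) → fvs (weaken P) ≡ fvs P
fvs-weaken (bv i)    = refl
fvs-weaken (fv y)    = refl
fvs-weaken (lam P)   = fvs-weaken P
fvs-weaken (app P Q) = cong₂ _++_ (fvs-weaken P) (fvs-weaken Q)

fvs-weakenTo : ∀ n (N : Tm 0) → fvs (weakenTo n N) ≡ fvs N
fvs-weakenTo zero    N = refl
fvs-weakenTo (suc n) N = trans (fvs-weaken (weakenTo n N)) (fvs-weakenTo n N)

punchIn-last : ∀ {m} (i : Fin m) → punchIn (fromℕ m) i ≡ inject₁ i
punchIn-last zero    = refl
punchIn-last (suc i) = cong suc (punchIn-last i)

close-last : ∀ {m} w (P : Tm m) → w ∉ fvs P → closeAt w (fromℕ m) P ≡ weaken P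
close-last w (bv i) _ = cong bv (punchIn-last i)
close-last w (fv y) w∉ rewrite ≡ᵇ-≢ {y} {w} (λ e → w∉ (here (sym e))) = refl
close-last w (lam P) w∉   = cong lam (close-last w P w∉)
close-last w (app P Q) w∉ = cong₂ app (close-last w P (∉-++ˡ w∉)) (close-last w Q (∉-++ʳ (fvs P) w∉))

close-substAt : ∀ {n} w x (N : Tm 0) (B : Tm n) → w ≢ x → w ∉ fvs N →
  closeAt w (fromℕ n) (substAt B x N) ≡ substAt (closeAt w (fromℕ n) B) x N
close-substAt w x N (bv i) _ _ = refl
close-substAt {n} w x N (fv y) w≢x w∉N with y ≟ x
... | yes refl rewrite ≡ᵇ-refl y | ≡ᵇ-≢ {y} {w} (λ e → w≢x (sym e)) | ≡ᵇ-refl y =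
  close-last w (weakenTo n N) (subst (w ∉_) (sym (fvs-weakenTo n N)) w∉N)
... | no y≢x rewrite ≡ᵇ-≢ y≢x with y ≟ w
...   | yes refl rewrite ≡ᵇ-refl y = refl
...   | no y≢w   rewrite ≡ᵇ-≢ y≢w | ≡ᵇ-≢ y≢x = refl
close-substAt w x N (lam B) w≢x w∉N   = cong lam (close-substAt w x N B w≢x w∉N)
close-substAt w x N (app P Q) w≢x w∉N = cong₂ app (close-substAt w x N P w≢x w∉N) (close-substAt w x N Q w≢x w∉N)

substAt-fresh : ∀ {n} (M : Tm n) x N → x ∉ fvs M → substAt M x N ≡ M
substAt-fresh (bv i) x N _ = refl
substAt-fresh (fv y) x N x∉ rewrite ≡ᵇ-≢ {y} {x} (λ e → x∉ (here (sym e))) = refl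
substAt-fresh (lam M) x N x∉   = cong lam (substAt-fresh M x N x∉)
substAt-fresh (app P Q) x N x∉ = cong₂ app (substAt-fresh P x N (∉-++ˡ x∉)) (substAt-fresh Q x N (∉-++ʳ (fvs P) x∉))

substAt-fv⁻ : ∀ {n} (M : Tm n) x N y → y ∈ fvs (substAt M x N) → (y ∈ fvs M × y ≢ x) ⊎ y ∈ fvs N
substAt-fv⁻ (bv i) x N y ()
substAt-fv⁻ {n} (fv z) x N y m with z ≟ x
... | yes refl rewrite ≡ᵇ-refl z | fvs-weakenTo n N = inj₂ m
... | no z≢x rewrite ≡ᵇ-≢ z≢x with m
...   | here refl = inj₁ (here refl , z≢x)
substAt-fv⁻ (lam M) x N y m = substAt-fv⁻ M x N y m
substAt-fv⁻ (app P Q) x N y m with ∈-++⁻ (fvs (substAt P x N)) m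
... | inj₁ m′ with substAt-fv⁻ P x N y m′
...   | inj₁ (y∈ , y≢x) = inj₁ (∈-++⁺ˡ y∈ , y≢x)
...   | inj₂ y∈N        = inj₂ y∈N
substAt-fv⁻ (app P Q) x N y m | inj₂ m′ with substAt-fv⁻ Q x N y m′
...   | inj₁ (y∈ , y≢x) = inj₁ (∈-++⁺ʳ (fvs P) y∈ , y≢x)
...   | inj₂ y∈N        = inj₂ y∈N

substAt-fv⁺ˡ : ∀ {n} (M : Tm n) x N y → y ∈ fvs M → y ≢ x → y ∈ fvs (substAt M x N)
substAt-fv⁺ˡ (bv i) x N y () _
substAt-fv⁺ˡ (fv z) x N y (here refl) y≢x rewrite ≡ᵇ-≢ y≢x = here refl
substAt-fv⁺ˡ (lam M) x N y m y≢x = substAt-fv⁺ˡ M x N y m y≢x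
substAt-fv⁺ˡ (app P Q) x N y m y≢x with ∈-++⁻ (fvs P) m
... | inj₁ m′ = ∈-++⁺ˡ (substAt-fv⁺ˡ P x N y m′ y≢x)
... | inj₂ m′ = ∈-++⁺ʳ (fvs (substAt P x N)) (substAt-fv⁺ˡ Q x N y m′ y≢x)

substAt-fv⁺ʳ : ∀ {n} (M : Tm n) x N y → y ∈ fvs N → x ∈ fvs M → y ∈ fvs (substAt M x N)
substAt-fv⁺ʳ (bv i) x N y _ ()
substAt-fv⁺ʳ {n} (fv z) x N y m (here refl) rewrite ≡ᵇ-refl z | fvs-weakenTo n N = m
substAt-fv⁺ʳ (lam M) x N y m x∈ = substAt-fv⁺ʳ M x N y m x∈
substAt-fv⁺ʳ (app P Q) x N y m x∈ with ∈-++⁻ (fvs P) x∈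
... | inj₁ x∈P = ∈-++⁺ˡ (substAt-fv⁺ʳ P x N y m x∈P)
... | inj₂ x∈Q = ∈-++⁺ʳ (fvs (substAt P x N)) (substAt-fv⁺ʳ Q x N y m x∈Q)

rename-binder : ∀ x (N : Tm 0) (P : Tm 0) (B : Tm 1) z w → closeAt z zero P ≡ substAt B x N →
  w ∉ fvs P → w ∉ fvs B → w ≢ x → w ∉ fvs N → swapTm z w P ≡ substAt (openAt w zero B) x N
rename-binder x N P B z w P≡B w∉P w∉B w≢x w∉N = close-injective w zero _ _ (begin
  closeAt w zero (swapTm z w P)              ≡⟨ cong (λ v → closeAt v zero (swapTm z w P)) (swap-a z w) ⟨
  closeAt (swap z w z) zero (swapTm z w P)   ≡⟨ swapTm-close z w z zero P ⟨
  swapTm z w (closeAt z zero P)              ≡⟨ swapTm-fresh z w (closeAt z zero P) z∉ w∉ ⟩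
  closeAt z zero P                           ≡⟨ P≡B ⟩
  substAt B x N                              ≡⟨ cong (λ t → substAt t x N) (close-open w zero B w∉B) ⟨
  substAt (closeAt w zero (openAt w zero B)) x N ≡⟨ close-substAt w x N (openAt w zero B) w≢x w∉N ⟨
  closeAt w zero (substAt (openAt w zero B) x N) ∎)
  where
  open ≡-Reasoning
  z∉ : z ∉ fvs (closeAt z zero P)
  z∉ m = proj₂ (close-fv⁻ z zero P z m) refl
  w∉ : w ∉ fvs (closeAt z zero P)
  w∉ m = w∉P (proj₁ (close-fv⁻ z zero P w m))

lam-injective : ∀ {n} {A B : Tm (suc n)} → lam A ≡ lam B → A ≡ B
lam-injective refl = refl

fresh : ∀ ks → Σ ℕ (λ w → w ∉ ks)
fresh ks = suc (sum ks) , λ m → 1+n≰n (∈⇒≤sum ks m)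
  where
  ∈⇒≤sum : ∀ {k} ks → k ∈ ks → k ≤ sum ks
  ∈⇒≤sum (k ∷ ks)  (here refl) = m≤m+n k (sum ks)
  ∈⇒≤sum (k′ ∷ ks) (there m)   = ≤-trans (∈⇒≤sum ks m) (m≤n+m (sum ks) k′)

-- 3. Properties of typing derivations

⊑ₜ-inv : ∀ {Γ U Γ′ U′} → ⟨ Γ ⊢ U ⟩⊑⟨ Γ′ ⊢ U′ ⟩ → U ⊑ U′ × Γ′ ⊑ₑ Γ
⊑ₜ-inv ⊑ₜ-refl = ⊑-refl , ⊑ₑ-refl (λ _ → refl)
⊑ₜ-inv (⊑ₜ-trans p q) with ⊑ₜ-inv p | ⊑ₜ-inv q
... | U⊑U′ , Γ′⊑Γ | U′⊑U″ , Γ″⊑Γ′ = ⊑-trans U⊑U′ U′⊑U″ , ⊑ₑ-trans Γ″⊑Γ′ Γ′⊑Γ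
⊑ₜ-inv (⊑ₜ-rule U⊑U′ Γ′⊑Γ) = U⊑U′ , Γ′⊑Γ

subsume : ∀ {M Γ U Γ′ U′} → M ∶⟨ Γ ⊢ U ⟩ → U ⊑ U′ → Γ′ ⊑ᵖ Γ → M ∶⟨ Γ′ ⊢ U′ ⟩
subsume d U⊑U′ Γ′⊑Γ = ⊑r d (⊑ₜ-rule U⊑U′ (⊑ᵖ⇒⊑ₑ Γ′⊑Γ))

retype : ∀ {M Γ Γ′ U} → M ∶⟨ Γ ⊢ U ⟩ → (∀ y → look Γ′ y ≡ look Γ y) → M ∶⟨ Γ′ ⊢ U ⟩
retype d eq = subsume d ⊑-refl (λ y → ⊑ᵐ-reflexive (eq y))

size : ∀ {M Γ U} → M ∶⟨ Γ ⊢ U ⟩ → ℕ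
size ax          = 0
size ω-r         = 0
size (→i _ d)    = suc (size d)
size (→i′ d _)   = suc (size d)
size (→e d₁ d₂)  = size d₁ + size d₂
size (⊓i d₁ d₂)  = size d₁ + size d₂
size (⊑r d _)    = size d

look-ω-∈ : ∀ ks y → y ∈ ks → look (map (λ z → (z , ω)) ks) y ≡ just ω
look-ω-∈ (k ∷ ks) y m with y ≟ k
... | yes refl = look-here {map (λ z → (z , ω)) ks} {y} {ω}
... | no y≢k rewrite look-there {map (λ z → (z , ω)) ks} {y} {k} {ω} y≢k with m
...   | here e     = ⊥-elim (y≢k e)
...   | there y∈ks = look-ω-∈ ks y y∈ks

keys-ω : ∀ ks → keys (map (λ z → (z , ω)) ks) ≡ ks
keys-ω []       = refl
keys-ω (k ∷ ks) = cong (k ∷_) (keys-ω ks)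

look-ω-∉ : ∀ ks y → y ∉ ks → look (map (λ z → (z , ω)) ks) y ≡ nothing
look-ω-∉ ks y y∉ = ∉keys (map (λ z → (z , ω)) ks) y (subst (y ∉_) (sym (keys-ω ks)) y∉)

transport : ∀ {M M′ Γ U} → M ≡ M′ → (d : M ∶⟨ Γ ⊢ U ⟩) → Σ (M′ ∶⟨ Γ ⊢ U ⟩) (λ d′ → size d′ ≡ size d)
transport refl d = d , refl

swapEnv : ℕ → ℕ → Env → Env
swapEnv a b []            = []
swapEnv a b ((z , U) ∷ Γ) = (swap a b z , U) ∷ swapEnv a b Γ

look-swapEnv : ∀ a b Γ y → look (swapEnv a b Γ) y ≡ look Γ (swap a b y)
look-swapEnv a b [] y = refl
look-swapEnv a b ((z , U) ∷ Γ) y with y ≟ swap a b z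
... | yes refl rewrite swap-involutive a b z =
  trans (look-here {swapEnv a b Γ} {swap a b z} {U}) (sym (look-here {Γ} {z} {U}))
... | no y≢ = trans (look-there {swapEnv a b Γ} {y} {swap a b z} {U} y≢)
               (trans (look-swapEnv a b Γ y)
                 (sym (look-there {Γ} {swap a b y} {z} {U} (λ e → y≢ (trans (sym (swap-involutive a b y)) (cong (swap a b) e))))))

swapEnv-∉dom : ∀ a b Γ x → x ∉dom Γ → swap a b x ∉dom swapEnv a b Γ
swapEnv-∉dom a b Γ x x∉ = trans (look-swapEnv a b Γ (swap a b x)) (trans (cong (look Γ) (swap-involutive a b x)) x∉)

swap-typing : ∀ a b {M Γ U} (d : M ∶⟨ Γ ⊢ U ⟩) →
  Σ (swapTm a b M ∶⟨ swapEnv a b Γ ⊢ U ⟩) (λ d′ → size d′ ≤ size d)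
swap-typing a b ax = ax , ≤-refl
swap-typing a b (ω-r {M}) = subsume ω-r ⊑-refl env , z≤n
  where
  env : swapEnv a b (env-ω M) ⊑ᵖ env-ω (swapTm a b M)
  env y rewrite look-swapEnv a b (env-ω M) y with swap a b y ∈? fvs M
  ... | yes m rewrite look-ω-∈ (fvs M) (swap a b y) m
                    | look-ω-∈ (fvs (swapTm a b M)) y
                        (subst (_∈ fvs (swapTm a b M)) (swap-involutive a b y) (swapTm-fv⁺ a b M (swap a b y) m)) = ⊑ᵐ-refl
  ... | no m  rewrite look-ω-∉ (fvs M) (swap a b y) m
                    | look-ω-∉ (fvs (swapTm a b M)) y (λ m′ → m (swapTm-fv⁻ a b M y m′)) = nothing⊑
swap-typing a b (→i {M} {Γ} {x} {U} {T} x∉ d) with swap-typing a b d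
... | d′ , d′≤ with transport (sym (cong lam (swapTm-close a b x zero M))) (→i (swapEnv-∉dom a b Γ x x∉) d′)
...   | d″ , d″≡ = d″ , subst (_≤ _) (sym d″≡) (s≤s d′≤)
swap-typing a b (→i′ {M} {Γ} {x} {T} d x∉) with swap-typing a b d
... | d′ , d′≤ with transport (sym (cong lam (swapTm-close a b x zero M))) (→i′ d′ (swapEnv-∉dom a b Γ x x∉))
...   | d″ , d″≡ = d″ , subst (_≤ _) (sym d″≡) (s≤s d′≤)
swap-typing a b (→e {Γ₁ = Γ₁} {Γ₂} d₁ d₂) with swap-typing a b d₁ | swap-typing a b d₂
... | d₁′ , d₁′≤ | d₂′ , d₂′≤ = retype (→e d₁′ d₂′) env , +-mono-≤ d₁′≤ d₂′≤
  where
  env : ∀ y → look (swapEnv a b (Γ₁ ⊓ₑ Γ₂)) y ≡ look (swapEnv a b Γ₁ ⊓ₑ swapEnv a b Γ₂) y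
  env y rewrite look-swapEnv a b (Γ₁ ⊓ₑ Γ₂) y | look-⊓ₑ Γ₁ Γ₂ (swap a b y)
              | look-⊓ₑ (swapEnv a b Γ₁) (swapEnv a b Γ₂) y
              | look-swapEnv a b Γ₁ y | look-swapEnv a b Γ₂ y = refl
swap-typing a b (⊓i d₁ d₂) with swap-typing a b d₁ | swap-typing a b d₂
... | d₁′ , d₁′≤ | d₂′ , d₂′≤ = ⊓i d₁′ d₂′ , +-mono-≤ d₁′≤ d₂′≤
swap-typing a b (⊑r {Γ = Γ} {Γ′ = Γ′} d s) with swap-typing a b d | ⊑ₜ-inv s
... | d′ , d′≤ | U⊑U′ , Γ′⊑Γ = subsume d′ U⊑U′ env , d′≤
  where
  env : swapEnv a b Γ′ ⊑ᵖ swapEnv a b Γ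
  env y rewrite look-swapEnv a b Γ′ y | look-swapEnv a b Γ y = ⊑ₑ⇒⊑ᵖ Γ′⊑Γ (swap a b y)

dom⊆fv : ∀ {M Γ U} → M ∶⟨ Γ ⊢ U ⟩ → ∀ y → y ∉ fvs M → look Γ y ≡ nothing
dom⊆fv (ax {x} {T}) y y∉ = look-there {[]} {y} {x} {⌜ T ⌝} (λ e → y∉ (here e))
dom⊆fv (ω-r {M}) y y∉ = look-ω-∉ (fvs M) y y∉
dom⊆fv (→i {M} {Γ} {x} {U} x∉ d) y y∉ with y ≟ x
... | yes refl = x∉
... | no y≢x   = trans (sym (look-there {Γ} {y} {x} {U} y≢x)) (dom⊆fv d y (λ m → y∉ (close-fv⁺ x zero M y m y≢x)))
dom⊆fv (→i′ {M} {Γ} {x} d x∉) y y∉ with y ≟ x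
... | yes refl = x∉
... | no y≢x   = dom⊆fv d y (λ m → y∉ (close-fv⁺ x zero M y m y≢x))
dom⊆fv (→e {M₁} {M₂} {Γ₁} {Γ₂} d₁ d₂) y y∉
  rewrite look-⊓ₑ Γ₁ Γ₂ y | dom⊆fv d₁ y (∉-++ˡ y∉) | dom⊆fv d₂ y (∉-++ʳ (fvs M₁) y∉) = refl
dom⊆fv (⊓i d₁ d₂) = dom⊆fv d₁
dom⊆fv (⊑r d s) y y∉ = ⊑ᵐ-nothingˡ (⊑ₑ⇒⊑ᵖ (proj₂ (⊑ₜ-inv s)) y) (dom⊆fv d y y∉)

fv⊆dom : ∀ {M Γ U} → M ∶⟨ Γ ⊢ U ⟩ → ∀ y → look Γ y ≡ nothing → y ∉ fvs M
fv⊆dom (ax {x} {T}) y Γy (here refl) with trans (sym (look-here {[]} {y} {⌜ T ⌝})) Γy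
... | ()
fv⊆dom (ω-r {M}) y Γy m with trans (sym (look-ω-∈ (fvs M) y m)) Γy
... | ()
fv⊆dom (→i {M} {Γ} {x} {U} _ d) y Γy m with close-fv⁻ x zero M y m
... | m′ , y≢x = fv⊆dom d y (trans (look-there {Γ} {y} {x} {U} y≢x) Γy) m′
fv⊆dom (→i′ {M} {x = x} d _) y Γy m = fv⊆dom d y Γy (proj₁ (close-fv⁻ x zero M y m))
fv⊆dom (→e {M₁} {M₂} {Γ₁} {Γ₂} d₁ d₂) y Γy m
  with meet-nothing (look Γ₁ y) (look Γ₂ y) (trans (sym (look-⊓ₑ Γ₁ Γ₂ y)) Γy) | ∈-++⁻ (fvs M₁) m
... | Γ₁y , _ | inj₁ m₁ = fv⊆dom d₁ y Γ₁y m₁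
... | _ , Γ₂y | inj₂ m₂ = fv⊆dom d₂ y Γ₂y m₂
fv⊆dom (⊓i d₁ d₂) = fv⊆dom d₁
fv⊆dom (⊑r d s) y Γy = fv⊆dom d y (⊑ᵐ-nothingʳ (⊑ₑ⇒⊑ᵖ (proj₂ (⊑ₜ-inv s)) y) Γy)

sameDom : ∀ {M Γ Δ U V} → M ∶⟨ Γ ⊢ U ⟩ → M ∶⟨ Δ ⊢ V ⟩ → ∀ y → SameDom (look Γ y) (look Δ y)
sameDom {M} {Γ} {Δ} d₁ d₂ y with y ∈? fvs M
... | no y∉ rewrite dom⊆fv d₁ y y∉ | dom⊆fv d₂ y y∉ = tt
... | yes y∈ with look Γ y in Γy | look Δ y in Δy
...   | just _  | just _  = tt
...   | nothing | _       = ⊥-elim (fv⊆dom d₁ y Γy y∈)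
...   | just _  | nothing = ⊥-elim (fv⊆dom d₂ y Δy y∈)

var-typing : ∀ x U → fv x ∶⟨ [] , x ∶ U ⊢ U ⟩
var-typing x ω       = ω-r
var-typing x (U ⊓ V) = ⊓i (subsume (var-typing x U) ⊑-refl (single ⊑-proj))
                          (subsume (var-typing x V) ⊑-refl (single (⊑-trans (⊑-≈ ≈-comm) ⊑-proj)))
  where
  single : ∀ {W W′} → W ⊑ W′ → ([] , x ∶ W) ⊑ᵖ ([] , x ∶ W′)
  single {W} {W′} W⊑W′ y with y ≟ x
  ... | yes refl rewrite look-here {[]} {y} {W} | look-here {[]} {y} {W′} = just⊑ W⊑W′
  ... | no y≢x   rewrite look-there {[]} {y} {x} {W} y≢x | look-there {[]} {y} {x} {W′} y≢x = nothing⊑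
var-typing x ⌜ T ⌝   = ax

⊓-typing : ∀ {M Γ Δ U V} → M ∶⟨ Γ ⊢ U ⟩ → M ∶⟨ Δ ⊢ V ⟩ → M ∶⟨ Γ ⊓ₑ Δ ⊢ U ⊓ V ⟩
⊓-typing {Γ = Γ} {Δ} dΓ dΔ = ⊓i (subsume dΓ ⊑-refl projˡ) (subsume dΔ ⊑-refl projʳ)
  where
  projˡ : (Γ ⊓ₑ Δ) ⊑ᵖ Γ
  projˡ y rewrite look-⊓ₑ Γ Δ y = meet-projˡ (look Γ y) (look Δ y) (sameDom dΓ dΔ y)
  projʳ : (Γ ⊓ₑ Δ) ⊑ᵖ Δ
  projʳ y rewrite look-⊓ₑ Γ Δ y = meet-projʳ (look Γ y) (look Δ y) (sameDom dΓ dΔ y)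

swapEnv-fresh : ∀ z w Γ → z ∉dom Γ → w ∉dom Γ → ∀ y → look (swapEnv z w Γ) y ≡ look Γ y
swapEnv-fresh z w Γ z∉ w∉ y = trans (look-swapEnv z w Γ y) (swapped y)
  where
  swapped : ∀ y → look Γ (swap z w y) ≡ look Γ y
  swapped y with y ≟ z
  ... | yes refl rewrite swap-a y w = trans w∉ (sym z∉)
  ... | no y≢z with y ≟ w
  ...   | yes refl rewrite swap-b z y = trans z∉ (sym w∉)
  ...   | no y≢w   rewrite swap-other z w y y≢z y≢w = refl

rename-free : ∀ {P Γ U} z w → z ∉dom Γ → w ∉dom Γ → (d : P ∶⟨ Γ ⊢ U ⟩) →
  Σ (swapTm z w P ∶⟨ Γ ⊢ U ⟩) (λ d′ → size d′ ≤ size d)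
rename-free {Γ = Γ} z w z∉ w∉ d with swap-typing z w d
... | d′ , d′≤ = retype d′ (λ y → sym (swapEnv-fresh z w Γ z∉ w∉ y)) , d′≤

rename-bound : ∀ {P Γ U T} z w → z ∉dom Γ → w ∉dom Γ → (d : P ∶⟨ Γ , z ∶ U ⊢ T ⟩) →
  Σ (swapTm z w P ∶⟨ Γ , w ∶ U ⊢ T ⟩) (λ d′ → size d′ ≤ size d)
rename-bound {Γ = Γ} {U} z w z∉ w∉ d with swap-typing z w d
... | d′ , d′≤ rewrite swap-a z w = retype d′ (look-∷-cong {Γ} {swapEnv z w Γ} w U (λ y → sym (swapEnv-fresh z w Γ z∉ w∉ y))) , d′≤

-- 4. Inversion of substitution

module Inversion (x : ℕ) (N : Tm 0) (x∉N : x ∉ fvs N) where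

  record Split (M : Tm 0) (Γ : Env) (U : 𝕌) : Set where
    constructor split
    field
      V     : 𝕌
      Γ₁ Γ₂ : Env
      x∉Γ₁  : x ∉dom Γ₁
      typeM : M ∶⟨ Γ₁ , x ∶ V ⊢ U ⟩
      typeN : N ∶⟨ Γ₂ ⊢ V ⟩
      Γ⊑    : Γ ⊑ₑ (Γ₁ ⊓ₑ Γ₂)

  -- M = x: N itself carries the type, and x gets that type.
  split-var : ∀ {Γ U} → N ∶⟨ Γ ⊢ U ⟩ → Split (fv x) Γ U
  split-var {Γ} {U} dN = split U [] Γ refl (var-typing x U) dN (⊑ₑ-refl (λ y → sym (⊓ₑ-identityˡ Γ y)))

  -- Rule (ω): M is typed by ω with every free variable at ω.
  split-ω : ∀ M → x ∈ fvs M → Split M (env-ω (substAt M x N)) ω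
  split-ω M x∈M = split ω (remove x (env-ω M)) (env-ω N) (remove-here x (env-ω M))
                        (retype ω-r (λ y → sym (remove-front x (env-ω M) (look-ω-∈ (fvs M) x x∈M) y)))
                        ω-r (⊑ᵖ⇒⊑ₑ bound)
    where
    S : Tm 0
    S = substAt M x N
    look-ω : ∀ (R : Tm 0) y → (y ∈ fvs R → look (env-ω R) y ≡ just ω) × (y ∉ fvs R → look (env-ω R) y ≡ nothing)
    look-ω R y = look-ω-∈ (fvs R) y , look-ω-∉ (fvs R) y
    x∉S : x ∉ fvs S
    x∉S m with substAt-fv⁻ M x N x m
    ... | inj₁ (_ , x≢x) = x≢x refl
    ... | inj₂ x∈N       = x∉N x∈N
    bound : env-ω S ⊑ᵖ (remove x (env-ω M) ⊓ₑ env-ω N)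
    bound y rewrite look-⊓ₑ (remove x (env-ω M)) (env-ω N) y with y ≟ x
    ... | yes refl rewrite remove-here y (env-ω M) | proj₂ (look-ω N y) x∉N | proj₂ (look-ω S y) x∉S = nothing⊑
    ... | no y≢x rewrite remove-there x (env-ω M) y y≢x with y ∈? fvs M | y ∈? fvs N
    ...   | yes y∈M | yes y∈N rewrite proj₁ (look-ω M y) y∈M | proj₁ (look-ω N y) y∈N
                               | proj₁ (look-ω S y) (substAt-fv⁺ˡ M x N y y∈M y≢x) = just⊑ (⊑-≈ (≈-sym ≈-idem))
    ...   | yes y∈M | no y∉N  rewrite proj₁ (look-ω M y) y∈M | proj₂ (look-ω N y) y∉N
                               | proj₁ (look-ω S y) (substAt-fv⁺ˡ M x N y y∈M y≢x) = ⊑ᵐ-refl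
    ...   | no y∉M  | yes y∈N rewrite proj₂ (look-ω M y) y∉M | proj₁ (look-ω N y) y∈N
                               | proj₁ (look-ω S y) (substAt-fv⁺ʳ M x N y y∈N x∈M) = ⊑ᵐ-refl
    ...   | no y∉M  | no y∉N  rewrite proj₂ (look-ω M y) y∉M | proj₂ (look-ω N y) y∉N =
      ⊑ᵐ-reflexive (proj₂ (look-ω S y) y∉S)
      where
      y∉S : y ∉ fvs S
      y∉S m with substAt-fv⁻ M x N y m
      ... | inj₁ (y∈M , _) = y∉M y∈M
      ... | inj₂ y∈N       = y∉N y∈N

  -- Rule (⊓i): the two splittings are met componentwise.
  split-⊓ : ∀ {M Γ U₁ U₂} → Split M Γ U₁ → Split M Γ U₂ → Split M Γ (U₁ ⊓ U₂)
  split-⊓ {Γ = Γ} (split V₁ Γa Γa′ x∉Γa dMa dNa Γ⊑a) (split V₂ Γb Γb′ x∉Γb dMb dNb Γ⊑b) =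
    split (V₁ ⊓ V₂) (Γa ⊓ₑ Γb) (Γa′ ⊓ₑ Γb′) (⊓ₑ-∉dom Γa Γb x∉Γa x∉Γb)
          (retype (⊓-typing dMa dMb) (λ y → sym (look-∷-⊓ₑ Γa Γb x V₁ V₂ y)))
          (⊓-typing dNa dNb)
          (⊑ₑ-trans (⊑ₑ-⊓-idem Γ) (⊑ₑ-interchange Γa Γb Γa′ Γb′ Γ⊑a Γ⊑b))

  split-⊑ : ∀ {M Γ U Γ′ U′} → Split M Γ U → ⟨ Γ ⊢ U ⟩⊑⟨ Γ′ ⊢ U′ ⟩ → Split M Γ′ U′
  split-⊑ (split V Γ₁ Γ₂ x∉Γ₁ dM dN Γ⊑) s with ⊑ₜ-inv s
  ... | U⊑U′ , Γ′⊑Γ = split V Γ₁ Γ₂ x∉Γ₁ (subsume dM U⊑U′ (λ _ → ⊑ᵐ-refl)) dN (⊑ₑ-trans Γ′⊑Γ Γ⊑)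

  split-app : ∀ {M₁ M₂ Γ Δ U T} → Split M₁ Γ ⌜ U ⇒ T ⌝ → Split M₂ Δ U → Split (app M₁ M₂) (Γ ⊓ₑ Δ) ⌜ T ⌝
  split-app (split V₁ Γa Γa′ x∉Γa dMa dNa Γ⊑a) (split V₂ Γb Γb′ x∉Γb dMb dNb Δ⊑b) =
    split (V₁ ⊓ V₂) (Γa ⊓ₑ Γb) (Γa′ ⊓ₑ Γb′) (⊓ₑ-∉dom Γa Γb x∉Γa x∉Γb)
          (retype (→e dMa dMb) (λ y → sym (look-∷-⊓ₑ Γa Γb x V₁ V₂ y)))
          (⊓-typing dNa dNb)
          (⊑ₑ-interchange Γa Γb Γa′ Γb′ Γ⊑a Δ⊑b)

  split-appˡ : ∀ {M₁ M₂ Γ Δ U T} → Split M₁ Γ ⌜ U ⇒ T ⌝ → x ∉ fvs M₂ → M₂ ∶⟨ Δ ⊢ U ⟩ →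
    Split (app M₁ M₂) (Γ ⊓ₑ Δ) ⌜ T ⌝
  split-appˡ {M₂ = M₂} {Δ = Δ} (split V₁ Γa Γa′ x∉Γa dMa dNa Γ⊑a) x∉M₂ dM₂ =
    split V₁ (Γa ⊓ₑ Δ) (Γa′ ⊓ₑ []) (⊓ₑ-∉dom Γa Δ x∉Γa x∉Δ)
          (retype (→e dMa dM₂) (λ y → sym (look-∷-⊓ₑˡ Γa Δ x V₁ x∉Δ y)))
          (retype dNa (⊓ₑ-identityʳ Γa′))
          (⊑ₑ-interchange Γa Δ Γa′ [] Γ⊑a (⊑ₑ-⊓-identityʳ Δ))
    where
    x∉Δ : x ∉dom Δ
    x∉Δ = dom⊆fv dM₂ x x∉M₂

  split-appʳ : ∀ {M₁ M₂ Γ Δ U T} → x ∉ fvs M₁ → M₁ ∶⟨ Γ ⊢ ⌜ U ⇒ T ⌝ ⟩ → Split M₂ Δ U →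
    Split (app M₁ M₂) (Γ ⊓ₑ Δ) ⌜ T ⌝
  split-appʳ {M₁ = M₁} {Γ = Γ} x∉M₁ dM₁ (split V₂ Γb Γb′ x∉Γb dMb dNb Δ⊑b) =
    split V₂ (Γ ⊓ₑ Γb) ([] ⊓ₑ Γb′) (⊓ₑ-∉dom Γ Γb x∉Γ x∉Γb)
          (retype (→e dM₁ dMb) (λ y → sym (look-∷-⊓ₑʳ Γ Γb x V₂ x∉Γ y)))
          (retype dNb (⊓ₑ-identityˡ Γb′))
          (⊑ₑ-interchange Γ Γb [] Γb′ (⊑ₑ-⊓-identityʳ Γ) Δ⊑b)
    where
    x∉Γ : x ∉dom Γ
    x∉Γ = dom⊆fv dM₁ x x∉M₁

  -- Rule (→i): the body, opened at a fresh w, was split at ⟨Γ , w : U⟩.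
  -- Since w ∉ FV(N), only the M-side environment declares w, with some
  -- U′ ⊒ U; abstracting w there types λ.B by U′ → T, hence by U → T.
  split-abs : ∀ {B Γ U T} w → w ∉ fvs B → w ≢ x → w ∉ fvs N → w ∉dom Γ →
    Split (openAt w zero B) (Γ , w ∶ U) ⌜ T ⌝ → Split (lam B) Γ ⌜ U ⇒ T ⌝
  split-abs {B} {Γ} {U} {T} w w∉B w≢x w∉N w∉Γ (split V Γa Γa′ x∉Γa dMa dNa Γ⊑)
    with ⊑ᵐ-justˡ (subst₂ _⊑ᵐ_ (look-here {Γ} {w} {U}) meet-at-w (⊑ₑ-⊓⇒meet Γa Γa′ Γ⊑ w))
    where
    -- N's environment does not declare w, as w ∉ FV(N).
    meet-at-w : meetM (look Γa w) (look Γa′ w) ≡ look Γa w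
    meet-at-w = trans (cong (meetM (look Γa w)) (dom⊆fv dNa w w∉N)) (meet-nothingʳ (look Γa w))
  ... | U′ , Γa-w , U⊑U′ =
    split V (remove w Γa) Γa′ (trans (remove-there w Γa x x≢w) x∉Γa) dM dNa (⊑ᵖ⇒⊑ₑ bound)
    where
    x≢w : x ≢ w
    x≢w e = w≢x (sym e)
    body : openAt w zero B ∶⟨ ((x , V) ∷ remove w Γa) , w ∶ U′ ⊢ ⌜ T ⌝ ⟩
    body = retype dMa λ y → sym (trans (remove-front w ((x , V) ∷ Γa) (trans (look-there {Γa} {w} {x} {V} w≢x) Γa-w) y)
                                       (cong (λ Δ → look ((w , U′) ∷ Δ) y) (remove-∷ Γa x≢w)))
    w∉Γ₁ : w ∉dom ((x , V) ∷ remove w Γa)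
    w∉Γ₁ = trans (look-there {remove w Γa} {w} {x} {V} w≢x) (remove-here w Γa)
    dM : lam B ∶⟨ remove w Γa , x ∶ V ⊢ ⌜ U ⇒ T ⌝ ⟩
    dM = subst (_∶⟨ remove w Γa , x ∶ V ⊢ ⌜ U ⇒ T ⌝ ⟩) (cong lam (close-open w zero B w∉B))
               (subsume (→i w∉Γ₁ body) (⊑-⇒ U⊑U′ ⊑-refl) (λ _ → ⊑ᵐ-refl))
    bound : Γ ⊑ᵖ (remove w Γa ⊓ₑ Γa′)
    bound y rewrite look-⊓ₑ (remove w Γa) Γa′ y with y ≟ w
    ... | yes refl rewrite w∉Γ | remove-here y Γa | dom⊆fv dNa y w∉N = nothing⊑
    ... | no y≢w   rewrite remove-there w Γa y y≢w =
      subst (_⊑ᵐ meetM (look Γa y) (look Γa′ y)) (look-there {Γ} {y} {w} {U} y≢w) (⊑ₑ-⊓⇒meet Γa Γa′ Γ⊑ y)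

  -- Rule (→′i): the bound variable does not occur, so the same
  -- environments type λ.B by ω → T.
  split-abs′ : ∀ {B Γ T} w → w ∉ fvs B → w ∉ fvs (openAt w zero B) →
    Split (openAt w zero B) Γ ⌜ T ⌝ → Split (lam B) Γ ⌜ ω ⇒ T ⌝
  split-abs′ {B} {Γ} {T} w w∉B w∉B′ (split V Γa Γa′ x∉Γa dMa dNa Γ⊑) =
    split V Γa Γa′ x∉Γa (subst (_∶⟨ Γa , x ∶ V ⊢ ⌜ ω ⇒ T ⌝ ⟩) (cong lam (close-open w zero B w∉B))
                                (→i′ dMa (dom⊆fv dMa w w∉B′)))
          dNa Γ⊑

  record FreshFor (P : Tm 0) (B : Tm 1) (Γ : Env) : Set where
    field
      w   : ℕ
      w∉P : w ∉ fvs P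
      w∉B : w ∉ fvs B
      w≢x : w ≢ x
      w∉N : w ∉ fvs N
      w∉Γ : w ∉dom Γ

  fresh-for : ∀ P B Γ → FreshFor P B Γ
  fresh-for P B Γ with fresh (fvs P ++ fvs B ++ x ∷ fvs N ++ keys Γ)
  ... | w , w∉ = record { w = w ; w∉P = ∉-++ˡ w∉ ; w∉B = ∉-++ˡ w∉B++ ; w≢x = λ e → w∉x∷ (here e)
                        ; w∉N = ∉-++ˡ w∉N++ ; w∉Γ = ∉keys Γ w (∉-++ʳ (fvs N) w∉N++) }
    where
    w∉B++ : w ∉ fvs B ++ x ∷ fvs N ++ keys Γ
    w∉B++ = ∉-++ʳ (fvs P) w∉
    w∉x∷ : w ∉ x ∷ fvs N ++ keys Γ
    w∉x∷ = ∉-++ʳ (fvs B) w∉B++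
    w∉N++ : w ∉ fvs N ++ keys Γ
    w∉N++ m = w∉x∷ (there m)

  split-→e : ∀ {M₁ M₂ Γ Δ U T} → (x ∈ fvs M₁ → Split M₁ Γ ⌜ U ⇒ T ⌝) → (x ∈ fvs M₂ → Split M₂ Δ U) →
    substAt M₁ x N ∶⟨ Γ ⊢ ⌜ U ⇒ T ⌝ ⟩ → substAt M₂ x N ∶⟨ Δ ⊢ U ⟩ → x ∈ fvs (app M₁ M₂) →
    Split (app M₁ M₂) (Γ ⊓ₑ Δ) ⌜ T ⌝
  split-→e {M₁} {M₂} IH₁ IH₂ d₁ d₂ x∈M with x ∈? fvs M₁ | x ∈? fvs M₂
  ... | yes x∈M₁ | yes x∈M₂ = split-app (IH₁ x∈M₁) (IH₂ x∈M₂)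
  ... | yes x∈M₁ | no x∉M₂  = split-appˡ (IH₁ x∈M₁) x∉M₂ (subst (_∶⟨ _ ⊢ _ ⟩) (substAt-fresh M₂ x N x∉M₂) d₂)
  ... | no x∉M₁  | yes x∈M₂ = split-appʳ x∉M₁ (subst (_∶⟨ _ ⊢ _ ⟩) (substAt-fresh M₁ x N x∉M₁) d₁) (IH₂ x∈M₂)
  ... | no x∉M₁  | no x∉M₂ with ∈-++⁻ (fvs M₁) x∈M
  ...   | inj₁ x∈M₁ = ⊥-elim (x∉M₁ x∈M₁)
  ...   | inj₂ x∈M₂ = ⊥-elim (x∉M₂ x∈M₂)

  Inverts : ℕ → Set
  Inverts n = ∀ {R Γ U} (d : R ∶⟨ Γ ⊢ U ⟩) → size d ≤ n → ∀ M → R ≡ substAt M x N → x ∈ fvs M → Split M Γ U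

  -- Rule (→i) with binder z: rename z to a fresh w, invert the body
  -- (a smaller derivation) and abstract w again.
  split-→i : ∀ {n P Γ z U T B} → Inverts n → z ∉dom Γ → (dP : P ∶⟨ Γ , z ∶ U ⊢ ⌜ T ⌝ ⟩) → size dP ≤ n →
    closeAt z zero P ≡ substAt B x N → x ∈ fvs B → Split (lam B) Γ ⌜ U ⇒ T ⌝
  split-→i {P = P} {Γ} {z} {U} {T} {B} IH z∉Γ dP dP≤n P≡B x∈B =
    split-abs w w∉B w≢x w∉N w∉Γ (IH dP′ (≤-trans dP′≤dP dP≤n) (openAt w zero B) P′≡ (open-fv w zero B x x∈B))
    where
    open FreshFor (fresh-for P B Γ)
    dP′ : swapTm z w P ∶⟨ Γ , w ∶ U ⊢ ⌜ T ⌝ ⟩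
    dP′ = proj₁ (rename-bound z w z∉Γ w∉Γ dP)
    dP′≤dP : size dP′ ≤ size dP
    dP′≤dP = proj₂ (rename-bound z w z∉Γ w∉Γ dP)
    P′≡ : swapTm z w P ≡ substAt (openAt w zero B) x N
    P′≡ = rename-binder x N P B z w P≡B w∉P w∉B w≢x w∉N

  split-→i′ : ∀ {n P Γ z T B} → Inverts n → z ∉dom Γ → (dP : P ∶⟨ Γ ⊢ ⌜ T ⌝ ⟩) → size dP ≤ n →
    closeAt z zero P ≡ substAt B x N → x ∈ fvs B → Split (lam B) Γ ⌜ ω ⇒ T ⌝
  split-→i′ {P = P} {Γ} {z} {T} {B} IH z∉Γ dP dP≤n P≡B x∈B =
    split-abs′ w w∉B w∉B′ (IH dP′ (≤-trans dP′≤dP dP≤n) (openAt w zero B) P′≡ (open-fv w zero B x x∈B))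
    where
    open FreshFor (fresh-for P B Γ)
    dP′ : swapTm z w P ∶⟨ Γ ⊢ ⌜ T ⌝ ⟩
    dP′ = proj₁ (rename-free z w z∉Γ w∉Γ dP)
    dP′≤dP : size dP′ ≤ size dP
    dP′≤dP = proj₂ (rename-free z w z∉Γ w∉Γ dP)
    P′≡ : swapTm z w P ≡ substAt (openAt w zero B) x N
    P′≡ = rename-binder x N P B z w P≡B w∉P w∉B w≢x w∉N
    -- w does not occur in the renamed body, since z ∉ FV(P).
    w∉B′ : w ∉ fvs (openAt w zero B)
    w∉B′ m = fv⊆dom dP z z∉Γ (subst (_∈ fvs P) (swap-b z w)
               (swapTm-fv⁻ z w P w (subst (λ t → w ∈ fvs t) (sym P′≡) (substAt-fv⁺ˡ (openAt w zero B) x N w m w≢x))))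

  split-subst : ∀ n → Inverts n
  split-subst n d _ (fv .x) R≡ (here refl) = split-var (subst (_∶⟨ _ ⊢ _ ⟩) (trans R≡ (if-≡ {y = x} refl)) d)
  split-subst n d _ (bv ()) _ _
  split-subst n ω-r _ M refl x∈M = split-ω M x∈M
  split-subst n (⊓i d₁ d₂) d≤n M R≡ x∈M =
    split-⊓ (split-subst n d₁ (m+n≤o⇒m≤o (size d₁) d≤n) M R≡ x∈M)
            (split-subst n d₂ (m+n≤o⇒n≤o (size d₁) d≤n) M R≡ x∈M)
  split-subst n (⊑r d s) d≤n M R≡ x∈M = split-⊑ (split-subst n d d≤n M R≡ x∈M) s
  split-subst n (→e d₁ d₂) d≤n (app M₁ M₂) refl x∈M =
    split-→e (split-subst n d₁ (m+n≤o⇒m≤o (size d₁) d≤n) M₁ refl)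
             (split-subst n d₂ (m+n≤o⇒n≤o (size d₁) d≤n) M₂ refl) d₁ d₂ x∈M
  split-subst (suc n) (→i z∉Γ dP) (s≤s dP≤n) (lam B) R≡ x∈B =
    split-→i (split-subst n) z∉Γ dP dP≤n (lam-injective R≡) x∈B
  split-subst (suc n) (→i′ dP z∉Γ) (s≤s dP≤n) (lam B) R≡ x∈B =
    split-→i′ (split-subst n) z∉Γ dP dP≤n (lam-injective R≡) x∈B
  split-subst n ax         _ (lam B)   () _
  split-subst n ax         _ (app P Q) () _
  split-subst n (→i _ _)   _ (app P Q) () _
  split-subst n (→i′ _ _)  _ (app P Q) () _
  split-subst n (→e _ _)   _ (lam B)   () _

open Inversion using (split; split-subst)

lemma3p8 : (M N : Tm 0) (x : ℕ) (Γ : Env) (U : 𝕌)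
    → (M [ x ≔ N ]) ∶⟨ Γ ⊢ U ⟩ → x ∈ fvs M → x ∉ fvs N
    → Σ 𝕌 (λ V → Σ Env (λ Γ₁ → Σ Env (λ Γ₂ →
    x ∉dom Γ₁ × M ∶⟨ Γ₁ , x ∶ V ⊢ U ⟩ × N ∶⟨ Γ₂ ⊢ V ⟩ × Γ ⊑ₑ (Γ₁ ⊓ₑ Γ₂))))
lemma3p8 M N x Γ U d x∈M x∉N with split-subst x N x∉N (size d) d ≤-refl M refl x∈M
... | split V Γ₁ Γ₂ x∉Γ₁ dM dN Γ⊑ = V , Γ₁ , Γ₂ , x∉Γ₁ , dM , dN , Γ⊑
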